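{- Let $d\geq 2$, $k\in\mathbb{N}_{>0}$ and $w\in\{1,\ldots,d\}^{\mathbb{N}}$. If for every pair of distinct letters $i,j\in\{1,\ldots,d\}$ we have $b^k_{\pi_{i,j}(w)}=p_{\pi_{i,j}(w)}$, then $b^k_w=p_w$.
   Context: The projection $\pi_{i,j}(w)$ of a word $w$ is obtained by erasing all letters other than $i$ and $j$. For finite words $u,x$, $\binom{u}{x}$ is the number of occurrences of $x$ in $u$ as a scattered subword ($\binom{u}{\epsilon}=1$); $u,v$ are $k$-binomially equivalent if $\binom{u}{x}=\binom{v}{x}$ for all words $x$ of length at most $k$. For a word $w$, $p_w(n)$ is the number of distinct factors (contiguous subwords) of length $n$ of $w$, and $b^k_w(n)$ is the number of $k$-binomial equivalence classes of its factors of length $n$; $b^k_w=p_w$ means equality for all $n$. -}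

module Defs where

open import Data.Nat using (ℕ; zero; suc; _+_; _≤_)
open import Data.Fin using (Fin; _≟_)
open import Data.List using (List; []; _∷_; length)
open import Data.List.Relation.Unary.All using (All)
open import Data.List.Relation.Unary.Any using (Any)
open import Data.List.Relation.Unary.AllPairs using (AllPairs)
open import Data.List.Membership.Propositional using (_∈_)
open import Data.Product using (Σ; ∃; _×_)
open import Relation.Nullary using (¬_; yes; no)
open import Relation.Binary.PropositionalEquality using (_≡_; _≢_)
open import Function.Bundles using (_⇔_)

Word : ℕ → Set
Word d = List (Fin d)

InfWord : ℕ → Set
InfWord d = ℕ → Fin d

-- binom u x : number of occurrences of x in u as a scattered subword.
binom : ∀ {d} → Word d → Word d → ℕ
binom u [] = 1
binom [] (_ ∷ _) = 0
binom (a ∷ u) (b ∷ x) with a ≟ b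
... | yes _ = binom u (b ∷ x) + binom u x
... | no  _ = binom u (b ∷ x)

BinEq : ∀ {d} → ℕ → Word d → Word d → Set
BinEq {d} k u v = (x : Word d) → length x ≤ k → binom u x ≡ binom v x

proj : ∀ {d} → Fin d → Fin d → Word d → Word d
proj i j [] = []
proj i j (a ∷ u) with a ≟ i | a ≟ j
... | yes _ | _     = a ∷ proj i j u
... | no _  | yes _ = a ∷ proj i j u
... | no _  | no _  = proj i j u

slice : ∀ {d} → InfWord d → ℕ → ℕ → Word d
slice w m zero = []
slice w m (suc n) = w m ∷ slice w (suc m) n

Factor : ∀ {d} → InfWord d → Word d → Set
Factor w u = ∃ λ m → slice w m (length u) ≡ u

-- Factors of the (possibly finite) word π_{i,j}(w): exactly the projections
-- of factors of w.
ProjFactor : ∀ {d} → Fin d → Fin d → InfWord d → Word d → Set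
ProjFactor i j w u = Σ ℕ λ m → Σ ℕ λ l → proj i j (slice w m l) ≡ u

-- FactorCount F n c : the set F has exactly c elements of length n
-- (i.e. p(n) = c), witnessed by a duplicate-free exhaustive list.
FactorCount : ∀ {d} → (Word d → Set) → ℕ → ℕ → Set
FactorCount {d} F n c =
  Σ (List (Word d)) λ L →
    length L ≡ c
    × AllPairs _≢_ L
    × All (λ u → F u × length u ≡ n) L
    × ((u : Word d) → F u → length u ≡ n → u ∈ L)

-- BinCount k F n c : the elements of F of length n fall into exactly c
-- k-binomial equivalence classes (i.e. b^k(n) = c), witnessed by a list of
-- pairwise inequivalent representatives covering all classes.
BinCount : ∀ {d} → ℕ → (Word d → Set) → ℕ → ℕ → Set
BinCount {d} k F n c =
  Σ (List (Word d)) λ L →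
    length L ≡ c
    × AllPairs (λ u v → ¬ BinEq k u v) L
    × All (λ u → F u × length u ≡ n) L
    × ((u : Word d) → F u → length u ≡ n → Any (BinEq k u) L)

BEqP : ∀ {d} → ℕ → (Word d → Set) → Set
BEqP k F = (n c : ℕ) → (BinCount k F n c ⇔ FactorCount F n c)

-- Call a set F of words k-rigid when any two k-binomially equivalent members of
-- equal length coincide. Counting shows that b^k = p on F exactly when F is
-- k-rigid. Two distinct factors u, v of w of equal length first differ at letters
-- a ≠ b, so π_{a,b} separates them; if u, v were k-binomially equivalent (k ≥ 1),
-- their projections would be k-binomially equivalent factors of π_{a,b}(w) of
-- equal length, contradicting the rigidity of π_{a,b}(w).
module Submission where

open import Defs
open import Data.Nat using (ℕ; zero; suc; _+_; _≤_; s≤s; z≤n)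
open import Data.Nat.Properties using (<-irrefl; ≤-trans; ≤-reflexive; suc-injective; +-suc; +-comm; module ≤-Reasoning)
import Data.Nat.Properties as ℕ
open import Data.Fin using (Fin; _≟_)
open import Data.List using (List; []; _∷_; [_]; length; removeAt; filter; deduplicate; cartesianProductWith; allFin)
open import Data.List.Properties using (≡-dec; ∷-injectiveˡ; ∷-injectiveʳ; length-removeAt′)
open import Data.List.Relation.Unary.All using (All; []; _∷_; sequenceM)
import Data.List.Relation.Unary.All as All
open import Data.List.Relation.Unary.All.Properties using (¬Any⇒All¬)
open import Data.List.Relation.Unary.Any using (Any; here; there; index)
import Data.List.Relation.Unary.Any as Any
open import Data.List.Relation.Unary.AllPairs using (AllPairs; []; _∷_)
import Data.List.Relation.Unary.AllPairs as AllPairs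
open import Data.List.Relation.Unary.Unique.Propositional using (Unique)
open import Data.List.Relation.Unary.Unique.DecPropositional.Properties using (deduplicate-!)
open import Data.List.Relation.Binary.Subset.Propositional using (_⊆_)
open import Data.List.Membership.Propositional using (_∈_; find)
import Data.List.Membership.DecPropositional as DecMembership
open import Data.List.Membership.Propositional.Properties
  using (∈-allFin; ∈-cartesianProductWith⁺; ∈-filter⁺; ∈-filter⁻; ∈-deduplicate⁺; ∈-deduplicate⁻; ∈-AllPairs₂)
open import Data.Product using (∃; _×_; _,_; proj₁; proj₂)
open import Data.Sum using (_⊎_; inj₁; inj₂; [_,_]′)
open import Function using (_∘_; case_of_)
open import Function.Bundles using (mk⇔; Equivalence)
open import Relation.Nullary using (¬_; Dec; yes; no; contradiction)
open import Relation.Nullary.Decidable using (map′; decidable-stable; ¬¬-excluded-middle; _⊎-dec_; toSum)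
open import Relation.Nullary.Negation using (¬¬-Monad; ¬¬-map)
open import Relation.Unary using (Decidable)
open import Relation.Binary using (DecidableEquality)
open import Relation.Binary.PropositionalEquality using (_≡_; _≢_; refl; sym; trans; cong; cong₂; subst; module ≡-Reasoning)

module _ {a} {A : Set a} where

  ∈-removeAt⁺ : ∀ {x y : A} {ys} (x∈ys : x ∈ ys) → y ∈ ys → y ≢ x → y ∈ removeAt ys (index x∈ys)
  ∈-removeAt⁺ (here refl) (here refl) y≢x = contradiction refl y≢x
  ∈-removeAt⁺ (here refl) (there y∈ys) _ = y∈ys
  ∈-removeAt⁺ (there _) (here refl) _ = here refl
  ∈-removeAt⁺ (there x∈ys) (there y∈ys) y≢x = there (∈-removeAt⁺ x∈ys y∈ys y≢x)

  Unique-⊆⇒length≤ : ∀ {xs ys : List A} → Unique xs → xs ⊆ ys → length xs ≤ length ys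
  Unique-⊆⇒length≤ {[]} _ _ = z≤n
  Unique-⊆⇒length≤ {x ∷ xs} {ys} (x∉xs ∷ xs!) xs⊆ys = begin
    suc (length xs)                            ≤⟨ s≤s (Unique-⊆⇒length≤ xs! xs⊆ys─x) ⟩
    suc (length (removeAt ys (index x∈ys)))    ≡⟨ length-removeAt′ ys (index x∈ys) ⟨
    length ys                                  ∎
    where
    open ≤-Reasoning
    x∈ys : x ∈ ys
    x∈ys = xs⊆ys (here refl)
    xs⊆ys─x : xs ⊆ removeAt ys (index x∈ys)
    xs⊆ys─x y∈xs = ∈-removeAt⁺ x∈ys (xs⊆ys (there y∈xs)) (λ y≡x → All.lookup x∉xs y∈xs (sym y≡x))

  Unique-⊆-length≥⇒⊇ : DecidableEquality A → ∀ {xs ys : List A} →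
    Unique xs → xs ⊆ ys → length ys ≤ length xs → ys ⊆ xs
  Unique-⊆-length≥⇒⊇ _≟A_ {xs} {ys} xs! xs⊆ys |ys|≤|xs| {z} z∈ys with DecMembership._∈?_ _≟A_ z xs
  ... | yes z∈xs = z∈xs
  ... | no z∉xs = contradiction |z∷xs|≤|xs| (<-irrefl refl)
    where
    z∷xs⊆ys : z ∷ xs ⊆ ys
    z∷xs⊆ys (here refl) = z∈ys
    z∷xs⊆ys (there y∈xs) = xs⊆ys y∈xs
    |z∷xs|≤|xs| : suc (length xs) ≤ length xs
    |z∷xs|≤|xs| = ≤-trans (Unique-⊆⇒length≤ (¬Any⇒All¬ xs z∉xs ∷ xs!) z∷xs⊆ys) |ys|≤|xs|

module _ {d : ℕ} where

  _≟W_ : DecidableEquality (Word d)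
  _≟W_ = ≡-dec _≟_

  ≡⇒BinEq : ∀ {k} {u v : Word d} → u ≡ v → BinEq k u v
  ≡⇒BinEq refl _ _ = refl

  BinEq-sym : ∀ {k} {u v : Word d} → BinEq k u v → BinEq k v u
  BinEq-sym u~v x |x|≤k = sym (u~v x |x|≤k)

  words : ℕ → List (Word d)
  words zero = [ [] ]
  words (suc m) = cartesianProductWith _∷_ (allFin d) (words m)

  ∈-words : (u : Word d) → u ∈ words (length u)
  ∈-words [] = here refl
  ∈-words (a ∷ u) = ∈-cartesianProductWith⁺ _∷_ (∈-allFin a) (∈-words u)

  -- F is arbitrary, so this step is classical; it is harmless because it is only
  -- used towards the decidable conclusion u ≡ v of rigidity.
  ¬¬-decidable-of-length : (F : Word d → Set) (m : ℕ) → ¬ ¬ Decidable (λ u → F u × length u ≡ m)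
  ¬¬-decidable-of-length F m =
    ¬¬-map decide (sequenceM _ ¬¬-Monad (All.tabulate {xs = words m} (λ _ → ¬¬-excluded-middle)))
    where
    decide : All (Dec ∘ F) (words m) → Decidable (λ u → F u × length u ≡ m)
    decide F? u with length u ℕ.≟ m
    ... | no |u|≢m = no (|u|≢m ∘ proj₂)
    ... | yes refl = map′ (_, refl) proj₁ (All.lookup F? (∈-words u))

  ¬¬-FactorCount : (F : Word d → Set) (m : ℕ) → ¬ ¬ ∃ (FactorCount F m)
  ¬¬-FactorCount F m = ¬¬-map count (¬¬-decidable-of-length F m)
    where
    count : Decidable (λ u → F u × length u ≡ m) → ∃ (FactorCount F m)
    count F? = length L , L , refl , deduplicate-! _≟W_ L₀
             , All.tabulate (proj₂ ∘ ∈-filter⁻ F? {xs = words m} ∘ ∈-deduplicate⁻ _≟W_ L₀)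
             , λ u Fu |u|≡m → ∈-deduplicate⁺ _≟W_ (∈-filter⁺ F? (subst (λ n → u ∈ words n) |u|≡m (∈-words u)) (Fu , |u|≡m))
      where
      L₀ = filter F? (words m)
      L = deduplicate _≟W_ L₀

BinRigid : ∀ {d} → ℕ → (Word d → Set) → Set
BinRigid k F = ∀ {u v} → F u → F v → length u ≡ length v → BinEq k u v → u ≡ v

module _ {d : ℕ} {k : ℕ} {F : Word d → Set} where

  BinRigid⇒BEqP : BinRigid k F → BEqP k F
  BinRigid⇒BEqP rigid n c = mk⇔ to from
    where
    to : BinCount k F n c → FactorCount F n c
    to (R , |R|≡c , R-inequiv , R-sound , R-complete) =
      R , |R|≡c , AllPairs.map (λ ¬u~v → ¬u~v ∘ ≡⇒BinEq) R-inequiv , R-sound , represented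
      where
      represented : (u : Word d) → F u → length u ≡ n → u ∈ R
      represented u Fu |u|≡n with r , r∈R , u~r ← find (R-complete u Fu |u|≡n) =
        let Fr , |r|≡n = All.lookup R-sound r∈R in
        subst (_∈ R) (sym (rigid Fu Fr (trans |u|≡n (sym |r|≡n)) u~r)) r∈R
    from : FactorCount F n c → BinCount k F n c
    from (L , |L|≡c , L! , L-sound , L-complete) =
      L , |L|≡c , inequivalent L-sound L! , L-sound , λ u Fu |u|≡n → Any.map ≡⇒BinEq (L-complete u Fu |u|≡n)
      where
      inequivalent : ∀ {L} → All (λ u → F u × length u ≡ n) L → Unique L → AllPairs (λ u v → ¬ BinEq k u v) L
      inequivalent [] [] = []
      inequivalent ((Fu , |u|≡n) ∷ L-sound) (u∉L ∷ L!) =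
        All.zipWith (λ { ((Fv , |v|≡n) , u≢v) → u≢v ∘ rigid Fu Fv (trans |u|≡n (sym |v|≡n)) }) (L-sound , u∉L)
        ∷ inequivalent L-sound L!

  -- A system of representatives R and the list L of all members of a given
  -- length have the same size, so R ⊆ L forces L ⊆ R.
  BEqP⇒BinRigid : BEqP k F → BinRigid k F
  BEqP⇒BinRigid b≡p {u} {v} Fu Fv |u|≡|v| u~v =
    decidable-stable (u ≟W v) (¬¬-map equal (¬¬-FactorCount F (length u)))
    where
    equal : ∃ (FactorCount F (length u)) → u ≡ v
    equal (c , fc@(L , |L|≡c , _ , _ , L-complete)) = members-equal (Equivalence.from (b≡p (length u) c) fc)
      where
      members-equal : BinCount k F (length u) c → u ≡ v
      members-equal (R , |R|≡c , R-inequiv , R-sound , _) =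
        case ∈-AllPairs₂ R-inequiv (L⊆R (L-complete u Fu refl)) (L⊆R (L-complete v Fv (sym |u|≡|v|))) of λ where
          (inj₁ u≡v) → u≡v
          (inj₂ (inj₁ ¬u~v)) → contradiction u~v ¬u~v
          (inj₂ (inj₂ ¬v~u)) → contradiction (BinEq-sym u~v) ¬v~u
        where
        R⊆L : R ⊆ L
        R⊆L r∈R = let Fr , |r|≡|u| = All.lookup R-sound r∈R in L-complete _ Fr |r|≡|u|
        L⊆R : L ⊆ R
        L⊆R = Unique-⊆-length≥⇒⊇ _≟W_ (AllPairs.map (λ ¬r~s → ¬r~s ∘ ≡⇒BinEq) R-inequiv) R⊆L
                (≤-reflexive (trans |L|≡c (sym |R|≡c)))

module _ {d : ℕ} (i j : Fin d) where

  OneOf : Fin d → Set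
  OneOf b = b ≡ i ⊎ b ≡ j

  proj-∷-injective : ∀ a {u v : Word d} → proj i j (a ∷ u) ≡ proj i j (a ∷ v) → proj i j u ≡ proj i j v
  proj-∷-injective a eq with a ≟ i | a ≟ j
  ... | yes _ | _ = ∷-injectiveʳ eq
  ... | no _ | yes _ = ∷-injectiveʳ eq
  ... | no _ | no _ = eq

  proj-∷ˡ : (u : Word d) → proj i j (i ∷ u) ≡ i ∷ proj i j u
  proj-∷ˡ u with i ≟ i
  ... | yes _ = refl
  ... | no i≢i = contradiction refl i≢i

  proj-∷ʳ : (u : Word d) → proj i j (j ∷ u) ≡ j ∷ proj i j u
  proj-∷ʳ u with j ≟ i | j ≟ j
  ... | yes _ | _ = refl
  ... | no _ | yes _ = refl
  ... | no _ | no j≢j = contradiction refl j≢j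

  proj-OneOf : (u : Word d) → All OneOf (proj i j u)
  proj-OneOf [] = []
  proj-OneOf (a ∷ u) with a ≟ i | a ≟ j
  ... | yes a≡i | _ = inj₁ a≡i ∷ proj-OneOf u
  ... | no _ | yes a≡j = inj₂ a≡j ∷ proj-OneOf u
  ... | no _ | no _ = proj-OneOf u

  length-proj : i ≢ j → (u : Word d) → length (proj i j u) ≡ binom u [ i ] + binom u [ j ]
  length-proj i≢j [] = refl
  length-proj i≢j (a ∷ u) with a ≟ i | a ≟ j
  ... | yes refl | yes refl = contradiction refl i≢j
  ... | yes _ | no _ = trans (cong suc (length-proj i≢j u)) (cong (_+ binom u [ j ]) (+-comm 1 _))
  ... | no _ | yes _ = trans (cong suc (length-proj i≢j u)) (trans (sym (+-suc _ _)) (cong (binom u [ i ] +_) (+-comm 1 _)))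
  ... | no _ | no _ = length-proj i≢j u

  binom-∷-cong : ∀ a b {u v x : Word d} → binom u (b ∷ x) ≡ binom v (b ∷ x) → binom u x ≡ binom v x →
    binom (a ∷ u) (b ∷ x) ≡ binom (a ∷ v) (b ∷ x)
  binom-∷-cong a b eq₁ eq₂ with a ≟ b
  ... | yes _ = cong₂ _+_ eq₁ eq₂
  ... | no _ = eq₁

  binom-proj : (u x : Word d) → All OneOf x → binom (proj i j u) x ≡ binom u x
  binom-proj u [] _ = refl
  binom-proj [] (_ ∷ _) _ = refl
  binom-proj (a ∷ u) (b ∷ x) (b∈ij ∷ x∈ij) with a ≟ i | a ≟ j
  ... | yes _ | _ = binom-∷-cong a b (binom-proj u (b ∷ x) (b∈ij ∷ x∈ij)) (binom-proj u x x∈ij)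
  ... | no _ | yes _ = binom-∷-cong a b (binom-proj u (b ∷ x) (b∈ij ∷ x∈ij)) (binom-proj u x x∈ij)
  ... | no a≢i | no a≢j with a ≟ b
  ...   | yes refl = contradiction b∈ij [ a≢i , a≢j ]′
  ...   | no _ = binom-proj u (b ∷ x) (b∈ij ∷ x∈ij)

  binom-¬OneOf : (z x : Word d) → All OneOf z → Any (¬_ ∘ OneOf) x → binom z x ≡ 0
  binom-¬OneOf [] (_ ∷ _) _ _ = refl
  binom-¬OneOf (a ∷ z) (b ∷ x) (a∈ij ∷ z∈ij) x∉ij with a ≟ b
  ... | no _ = binom-¬OneOf z (b ∷ x) z∈ij x∉ij
  ... | yes refl = cong₂ _+_ (binom-¬OneOf z (a ∷ x) z∈ij x∉ij) (binom-¬OneOf z x z∈ij (tail-outside x∉ij))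
    where
    tail-outside : Any (¬_ ∘ OneOf) (a ∷ x) → Any (¬_ ∘ OneOf) x
    tail-outside (here a∉ij) = contradiction a∈ij a∉ij
    tail-outside (there x∉ij) = x∉ij

  BinEq-proj : ∀ {k} {u v : Word d} → BinEq k u v → BinEq k (proj i j u) (proj i j v)
  BinEq-proj {u = u} {v} u~v x |x|≤k with All.decide (λ b → toSum ((b ≟ i) ⊎-dec (b ≟ j))) x
  ... | inj₁ x∈ij = trans (binom-proj u x x∈ij) (trans (u~v x |x|≤k) (sym (binom-proj v x x∈ij)))
  ... | inj₂ x∉ij = trans (binom-¬OneOf _ x (proj-OneOf u) x∉ij) (sym (binom-¬OneOf _ x (proj-OneOf v) x∉ij))

-- At the first position where u and v differ, with letters a ≠ b, π_{a,b} differs too.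
proj-separates : ∀ {d} (u v : Word d) → length u ≡ length v → u ≢ v →
  ∃ λ i → ∃ λ j → i ≢ j × proj i j u ≢ proj i j v
proj-separates [] [] _ u≢v = contradiction refl u≢v
proj-separates (a ∷ u) (b ∷ v) |u|≡|v| au≢bv with a ≟ b
... | yes refl =
  let i , j , i≢j , πu≢πv = proj-separates u v (suc-injective |u|≡|v|) (au≢bv ∘ cong (a ∷_)) in
  i , j , i≢j , πu≢πv ∘ proj-∷-injective i j a
... | no a≢b =
  a , b , a≢b , λ πau≡πbv → a≢b (∷-injectiveˡ (trans (sym (proj-∷ˡ a b u)) (trans πau≡πbv (proj-∷ʳ a b v))))

module _ {d : ℕ} {k : ℕ} (w : InfWord d) where

  Factor⇒ProjFactor : ∀ i j {u} → Factor w u → ProjFactor i j w (proj i j u)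
  Factor⇒ProjFactor i j {u} (m , slice≡u) = m , length u , cong (proj i j) slice≡u

  BinRigid-projections⇒BinRigid : 1 ≤ k → (∀ i j → i ≢ j → BinRigid k (ProjFactor i j w)) → BinRigid k (Factor w)
  BinRigid-projections⇒BinRigid 1≤k rigid {u} {v} Fu Fv |u|≡|v| u~v =
    decidable-stable (u ≟W v) λ u≢v →
      let i , j , i≢j , πu≢πv = proj-separates u v |u|≡|v| u≢v in
      πu≢πv (rigid i j i≢j (Factor⇒ProjFactor i j Fu) (Factor⇒ProjFactor i j Fv)
                         (|proj| i j i≢j) (BinEq-proj i j u~v))
    where
    |proj| : ∀ i j → i ≢ j → length (proj i j u) ≡ length (proj i j v)
    |proj| i j i≢j = begin
      length (proj i j u)          ≡⟨ length-proj i j i≢j u ⟩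
      binom u [ i ] + binom u [ j ] ≡⟨ cong₂ _+_ (u~v [ i ] 1≤k) (u~v [ j ] 1≤k) ⟩
      binom v [ i ] + binom v [ j ] ≡⟨ length-proj i j i≢j v ⟨
      length (proj i j v)          ∎
      where open ≡-Reasoning

lemma2 : (d : ℕ) → 2 ≤ d → (k : ℕ) → 1 ≤ k → (w : InfWord d)
    → ((i j : Fin d) → i ≢ j → BEqP k (ProjFactor i j w))
    → BEqP k (Factor w)
lemma2 d _ k 1≤k w b≡p-on-projections =
  BinRigid⇒BEqP (BinRigid-projections⇒BinRigid w 1≤k (λ i j i≢j → BEqP⇒BinRigid (b≡p-on-projections i j i≢j)))
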